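{- Let $k \geq 2$ be an even integer and let $n \geq 2(k+1)$. Let $A = \{1,\ldots,k+1\}$ and define $f \colon S_n \to \{0,1\}$ by \[ f(\pi) = 1 \text{ if } \pi(A) = A \text{ or } \pi(A) \cap A = \emptyset, \qquad f(\pi) = 0 \text{ otherwise}. \] Then $f$ belongs to $V_k$. Moreover, the support of $f$ contains no $k$-coset. Consequently, $f$ is not the characteristic function of a disjoint union of $k$-cosets.
   Context: For $n \ge 1$, $S_n$ denotes the symmetric group on $[n]=\{1,\ldots,n\}$. Let $\mathcal{A}_k$ be the set of ordered $k$-tuples of distinct elements of $[n]$. For $\alpha=(\alpha_1,\ldots,\alpha_k)$ and $\beta=(\beta_1,\ldots,\beta_k)$ in $\mathcal{A}_k$, the $k$-coset $T_{\alpha\mapsto\beta}$ is defined as $\{\pi\in S_n : \pi(\alpha_1)=\beta_1,\ldots,\pi(\alpha_k)=\beta_k\}$. Let $V_k$ be the linear span, inside the real vector space of all functions $S_n\to\mathbb{R}$, of the characteristic functions of all $k$-cosets. The support of $f$ is $\{\pi : f(\pi)\neq 0\}$. -}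

module Defs where

open import Data.Nat using (ℕ; _≤_)
open import Data.Fin using (Fin; toℕ)
open import Data.Fin.Properties using (all?; _≟_)
open import Data.Fin.Permutation using (Permutation′; _⟨$⟩ʳ_)
open import Data.Rational using (ℚ; 0ℚ; 1ℚ; _+_; _*_)
open import Data.List using (List; foldr; map)
open import Data.List.Relation.Unary.Any using (Any)
open import Data.List.Relation.Unary.AllPairs using (AllPairs)
open import Data.Product using (Σ; ∃; _×_; _,_)
open import Data.Bool using (if_then_else_)
open import Function.Definitions using (Injective)
open import Relation.Binary.PropositionalEquality using (_≡_)
open import Relation.Nullary using (¬_)
open import Relation.Nullary.Decidable using (⌊_⌋)

Sym : ℕ → Set
Sym n = Permutation′ n

Tuple : ℕ → ℕ → Set
Tuple k n = Σ (Fin k → Fin n) (Injective _≡_ _≡_)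

-- a k-coset T_{α ↦ β} is given by a pair (α , β)
Coset : ℕ → ℕ → Set
Coset k n = Tuple k n × Tuple k n

_∈T_ : ∀ {k n} → Sym n → Coset k n → Set
π ∈T ((α , _) , (β , _)) = ∀ i → π ⟨$⟩ʳ α i ≡ β i

χ : ∀ {k n} → Coset k n → Sym n → ℚ
χ ((α , _) , (β , _)) π = if ⌊ all? (λ i → π ⟨$⟩ʳ α i ≟ β i) ⌋ then 1ℚ else 0ℚ

InV : ∀ {n} (k : ℕ) → (Sym n → ℚ) → Set
InV {n} k g = ∃ λ (terms : List (ℚ × Coset k n)) →
  ∀ π → g π ≡ foldr _+_ 0ℚ (map (λ { (c , T) → c * χ T π }) terms)

InSupport : ∀ {n} → (Sym n → ℚ) → Sym n → Set
InSupport g π = ¬ (g π ≡ 0ℚ)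

SupportContainsCoset : ∀ {n} (k : ℕ) → (Sym n → ℚ) → Set
SupportContainsCoset {n} k g = ∃ λ (T : Coset k n) → ∀ π → π ∈T T → InSupport g π

DisjointCosets : ∀ {k n} → Coset k n → Coset k n → Set
DisjointCosets {n = n} T U = (π : Sym n) → π ∈T T → π ∈T U → Data.Empty.⊥
  where import Data.Empty

IsCharDisjointUnion : ∀ {n} (k : ℕ) → (Sym n → ℚ) → Set
IsCharDisjointUnion {n} k g = ∃ λ (Ts : List (Coset k n)) →
  AllPairs DisjointCosets Ts ×
  (∀ π → (Any (π ∈T_) Ts → g π ≡ 1ℚ) × (¬ Any (π ∈T_) Ts → g π ≡ 0ℚ))

-- the set A = {1,…,k+1}, i.e. {0,…,k} in 0-indexed Fin n
InA : ∀ {n} (k : ℕ) → Fin n → Set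
InA k a = toℕ a ≤ k

InImageA : ∀ {n} (k : ℕ) → Sym n → Fin n → Set
InImageA k π b = ∃ λ a → InA k a × π ⟨$⟩ʳ a ≡ b

ImageEqA : ∀ {n} (k : ℕ) → Sym n → Set
ImageEqA {n} k π = (b : Fin n) → (InImageA k π b → InA k b) × (InA k b → InImageA k π b)

ImageDisjA : ∀ {n} (k : ℕ) → Sym n → Set
ImageDisjA {n} k π = (b : Fin n) → InImageA k π b → InA k b → Data.Empty.⊥
  where import Data.Empty

module Submission where

-- Let Y ∈ Bool^{k+1} record which points of A return to A, so that
-- f π = [Y all false] + [Y all true], and let step_j(Y) mean Y = (true^j, false^{k+1-j}).
-- Deleting coordinate a of Y leaves a step vector at a iff Y is a step vector at a or a+1,
-- so telescoping gives  Σ_{a ≤ k} (-1)^a step_a(Y ∖ a) = step_0(Y) + (-1)^k step_{k+1}(Y),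
-- which is f π for even k.  The a-th summand is a function of π restricted to A ∖ {a}, and
-- every such function is a combination of indicators of k-cosets T_{A∖{a} ↦ β}.
--
-- In a coset T_{α ↦ β} some a ∈ A is free; redirecting it to a target
-- outside the β's, inside A or inside a block of k+1 points outside A (here n ≥ 2(k+1) is
-- used), yields a member sending part of A into A and part outside, where f = 0.  As
-- f(id) = 1, f is then not the indicator of a disjoint union of k-cosets either.

open import Defs
open import Data.Nat using (ℕ; _≤_; _*_; suc)
open import Data.Nat.Divisibility using (_∣_)
open import Data.Rational using (ℚ; 0ℚ; 1ℚ)
open import Data.Sum using (_⊎_)
open import Data.Product using (_×_)
open import Relation.Binary.PropositionalEquality using (_≡_)
open import Relation.Nullary using (¬_)

open import Data.Nat as ℕ using (zero; _<_; _≤?_; s≤s; z≤n)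
import Data.Nat.Properties as ℕP
open import Data.Nat.Divisibility using (divides)
open import Data.Fin using (Fin; zero; suc; toℕ; inject≤; fromℕ<; punchIn; punchOut)
open import Data.Fin.Properties
  using (_≟_; all?; any?; pigeonhole; toℕ-injective; toℕ-inject≤; toℕ-fromℕ<; toℕ<n;
         inject≤-injective; punchIn-injective; punchInᵢ≢i; punchIn-punchOut; suc-injective; 0≢1+n)
open import Data.Fin.Permutation using (_⟨$⟩ʳ_; _∘ₚ_; transpose; id)
open import Data.Vec.Functional as Vector using (Vector; head; tail; removeAt)
open import Data.Bool using (Bool; true; false; not; _∧_; if_then_else_)
open import Data.Rational as ℚ using (-_; _+_)
import Data.Rational.Properties as ℚP
open import Data.Rational.Solver using (module +-*-Solver)
open import Algebra.Properties.CommutativeMonoid.Sum ℚP.+-0-commutativeMonoid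
  using (sum; sum-cong-≗; sum-remove; sum-replicate-zero)
open import Algebra.Properties.Group ℚP.+-0-group using (⁻¹-involutive)
open import Data.List as List using (List; foldr; map; _++_)
open import Data.List.Relation.Unary.Any using (here)
open import Data.Product using (∃; _,_; proj₁; proj₂)
open import Data.Sum using (inj₁; inj₂)
open import Data.Empty using (⊥-elim)
open import Function using (_∘_; Injection; Equivalence; _⇔_; mk⇔)
open import Function.Definitions using (Injective)
open import Function.Properties.Inverse using (↔⇒↣)
open import Relation.Binary.PropositionalEquality
  using (_≢_; _≗_; refl; sym; trans; cong; cong₂; subst; module ≡-Reasoning)
open import Relation.Nullary using (Dec; yes; no; does; ¬?; contradiction)
open import Relation.Nullary.Decidable using (_→-dec_; dec-true; dec-false)

open ≡-Reasoning

𝟙 : Bool → ℚ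
𝟙 b = if b then 1ℚ else 0ℚ

sum-neg : ∀ {m} (t : Vector ℚ m) → sum (λ i → - t i) ≡ - sum t
sum-neg {zero}  t = refl
sum-neg {suc m} t = begin
  - t zero + sum (λ i → - tail t i) ≡⟨ cong (- t zero +_) (sum-neg (tail t)) ⟩
  - t zero + - sum (tail t)         ≡⟨ ℚP.neg-distrib-+ (t zero) (sum (tail t)) ⟨
  - (t zero + sum (tail t))         ∎

sum-delta : ∀ {m} (t : Vector ℚ m) i → (∀ j → j ≢ i → t j ≡ 0ℚ) → sum t ≡ t i
sum-delta {suc m} t i others = begin
  sum t                          ≡⟨ sum-remove t ⟩
  t i + sum (removeAt t i)       ≡⟨ cong (t i +_) (sum-cong-≗ (λ j → others _ (punchInᵢ≢i i j))) ⟩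
  t i + sum (Vector.replicate m 0ℚ) ≡⟨ cong (t i +_) (sum-replicate-zero m) ⟩
  t i + 0ℚ                       ≡⟨ ℚP.+-identityʳ (t i) ⟩
  t i                            ∎

sign : ℕ → ℚ
sign zero    = 1ℚ
sign (suc m) = - sign m

sign-even : ∀ q → sign (q * 2) ≡ 1ℚ
sign-even zero    = refl
sign-even (suc q) = trans (⁻¹-involutive (sign (q * 2))) (sign-even q)

telescope : ∀ m (q : ℕ → ℚ) →
  sum (λ (a : Fin (suc m)) → sign (toℕ a) ℚ.* (q (toℕ a) + q (suc (toℕ a))))
    ≡ q 0 + sign m ℚ.* q (suc m)
telescope zero    q = base (q 0) (q 1)
  where
  open +-*-Solver
  base : ∀ a b → 1ℚ ℚ.* (a + b) + 0ℚ ≡ a + 1ℚ ℚ.* b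
  base = solve 2 (λ a b → con 1ℚ :* (a :+ b) :+ con 0ℚ := a :+ con 1ℚ :* b) refl
telescope (suc m) q = begin
  1ℚ ℚ.* (q 0 + q 1) + sum (λ a → - sign (toℕ a) ℚ.* shiftedPair a)
    ≡⟨ cong (1ℚ ℚ.* (q 0 + q 1) +_) (trans (sum-cong-≗ negate-inside) (sum-neg shifted)) ⟩
  1ℚ ℚ.* (q 0 + q 1) + - sum shifted
    ≡⟨ cong (λ s → 1ℚ ℚ.* (q 0 + q 1) + - s) (telescope m q′) ⟩
  1ℚ ℚ.* (q 0 + q 1) + - (q 1 + sign m ℚ.* q (suc (suc m)))
    ≡⟨ cancel (q 0) (q 1) (sign m) (q (suc (suc m))) ⟩
  q 0 + - sign m ℚ.* q (suc (suc m)) ∎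
  where
  q′ : ℕ → ℚ
  q′ j = q (suc j)
  shiftedPair : Fin (suc m) → ℚ
  shiftedPair a = q′ (toℕ a) + q′ (suc (toℕ a))
  shifted : Vector ℚ (suc m)
  shifted a = sign (toℕ a) ℚ.* shiftedPair a
  negate-inside : ∀ a → - sign (toℕ a) ℚ.* shiftedPair a ≡ - shifted a
  negate-inside a = sym (ℚP.neg-distribˡ-* (sign (toℕ a)) (shiftedPair a))
  open +-*-Solver
  cancel : ∀ a b s c → 1ℚ ℚ.* (a + b) + - (b + s ℚ.* c) ≡ a + - s ℚ.* c
  cancel = solve 4 (λ a b s c → con 1ℚ :* (a :+ b) :+ :- (b :+ s :* c) := a :+ (:- s) :* c) refl

-- isStep j Y: Y = (true, …, true, false, …, false) with the first j entries true
-- (all of them, when j exceeds the length).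
isStep : ∀ {m} → ℕ → Vector Bool m → Bool
isStep {zero}  _       _ = true
isStep {suc m} zero    Y = not (head Y) ∧ isStep zero (tail Y)
isStep {suc m} (suc j) Y = head Y ∧ isStep j (tail Y)

-- isStep only depends on the entries of its argument (there is no function extensionality).
isStep-cong : ∀ {m} j {Y Z : Vector Bool m} → Y ≗ Z → isStep j Y ≡ isStep j Z
isStep-cong {zero}  _       _   = refl
isStep-cong {suc m} zero    Y≗Z = cong₂ (λ b c → not b ∧ c) (Y≗Z zero) (isStep-cong zero (Y≗Z ∘ suc))
isStep-cong {suc m} (suc j) Y≗Z = cong₂ _∧_ (Y≗Z zero) (isStep-cong j (Y≗Z ∘ suc))

isStep-none : ∀ {m} (Y : Vector Bool m) → isStep 0 Y ≡ true → ∀ i → Y i ≡ false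
isStep-none {suc m} Y e i with Y zero in y₀
isStep-none {suc m} Y e zero    | false = y₀
isStep-none {suc m} Y e (suc i) | false = isStep-none (tail Y) e i

isStep-none⁻¹ : ∀ {m} (Y : Vector Bool m) → (∀ i → Y i ≡ false) → isStep 0 Y ≡ true
isStep-none⁻¹ {zero}  Y allFalse = refl
isStep-none⁻¹ {suc m} Y allFalse rewrite allFalse zero = isStep-none⁻¹ (tail Y) (allFalse ∘ suc)

isStep-all : ∀ {m} (Y : Vector Bool m) → isStep m Y ≡ true → ∀ i → Y i ≡ true
isStep-all {suc m} Y e i with Y zero in y₀
isStep-all {suc m} Y e zero    | true = y₀
isStep-all {suc m} Y e (suc i) | true = isStep-all (tail Y) e i

isStep-all⁻¹ : ∀ {m} (Y : Vector Bool m) → (∀ i → Y i ≡ true) → isStep m Y ≡ true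
isStep-all⁻¹ {zero}  Y allTrue = refl
isStep-all⁻¹ {suc m} Y allTrue rewrite allTrue zero = isStep-all⁻¹ (tail Y) (allTrue ∘ suc)

-- Deleting coordinate a leaves the step vector at a iff Y is the step vector at a or a+1
-- (the two cases differ only in the deleted entry).
isStep-removeAt : ∀ {k} (Y : Vector Bool (suc k)) (a : Fin (suc k)) →
  𝟙 (isStep (toℕ a) (removeAt Y a)) ≡ 𝟙 (isStep (toℕ a) Y) + 𝟙 (isStep (suc (toℕ a)) Y)
isStep-removeAt Y zero = split (Y zero) (isStep 0 (tail Y))
  where
  split : ∀ b s → 𝟙 s ≡ 𝟙 (not b ∧ s) + 𝟙 (b ∧ s)
  split false false = refl
  split false true  = refl
  split true  false = refl
  split true  true  = refl
isStep-removeAt {suc k} Y (suc a) with Y zero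
... | false = refl
... | true  = isStep-removeAt (tail Y) a

alternating-removeAt : ∀ k (Y : Vector Bool (suc k)) →
  sum (λ a → sign (toℕ a) ℚ.* 𝟙 (isStep (toℕ a) (removeAt Y a)))
    ≡ 𝟙 (isStep 0 Y) + sign k ℚ.* 𝟙 (isStep (suc k) Y)
alternating-removeAt k Y =
  trans (sum-cong-≗ (λ a → cong (sign (toℕ a) ℚ.*_) (isStep-removeAt Y a)))
        (telescope k (λ j → 𝟙 (isStep j Y)))

foldr-map-++ : ∀ {X : Set} (φ : X → ℚ) xs ys →
  foldr _+_ 0ℚ (map φ (xs ++ ys)) ≡ foldr _+_ 0ℚ (map φ xs) + foldr _+_ 0ℚ (map φ ys)
foldr-map-++ φ List.[]       ys = sym (ℚP.+-identityˡ _)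
foldr-map-++ φ (x List.∷ xs) ys =
  trans (cong (φ x +_) (foldr-map-++ φ xs ys)) (sym (ℚP.+-assoc (φ x) _ _))

InV-cong : ∀ {n} {k} {g h : Sym n → ℚ} → (∀ π → g π ≡ h π) → InV k h → InV k g
InV-cong g≗h (ts , h≗ts) = ts , λ π → trans (g≗h π) (h≗ts π)

InV-zero : ∀ {n} {k} → InV {n} k (λ _ → 0ℚ)
InV-zero = List.[] , λ _ → refl

InV-coset : ∀ {n} {k} c (T : Coset k n) → InV k (λ π → c ℚ.* χ T π)
InV-coset c T = List.[ (c , T) ] , λ π → sym (ℚP.+-identityʳ _)

InV-sum : ∀ {n} k m (g : Fin m → Sym n → ℚ) → (∀ i → InV k (g i)) → InV k (λ π → sum (λ i → g i π))
InV-sum k zero    g _     = InV-zero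
InV-sum k (suc m) g g∈V with g∈V zero | InV-sum k m (g ∘ suc) (g∈V ∘ suc)
... | ts , g₀≗ts | us , rest≗us =
  ts ++ us , λ π → trans (cong₂ _+_ (g₀≗ts π) (rest≗us π)) (sym (foldr-map-++ _ ts us))

sumMaps : ∀ {n} j → ((Fin j → Fin n) → ℚ) → ℚ
sumMaps zero    E = E Vector.[]
sumMaps (suc j) E = sum (λ b → sumMaps j (λ β → E (b Vector.∷ β)))

InV-sumMaps : ∀ {n} k j (g : (Fin j → Fin n) → Sym n → ℚ) → (∀ β → InV k (g β)) →
  InV k (λ π → sumMaps j (λ β → g β π))
InV-sumMaps     k zero    g g∈V = g∈V Vector.[]
InV-sumMaps {n} k (suc j) g g∈V = InV-sum k n _ (λ b → InV-sumMaps k j _ (g∈V ∘ (b Vector.∷_)))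

sumMaps-concentrated : ∀ {n} j (E : (Fin j → Fin n) → ℚ) (γ : Fin j → Fin n) →
  (∀ β → ¬ β ≗ γ → E β ≡ 0ℚ) → ∃ λ γ′ → γ′ ≗ γ × sumMaps j E ≡ E γ′
sumMaps-concentrated zero    E γ _      = Vector.[] , (λ ()) , refl
sumMaps-concentrated (suc j) E γ vanish =
  let (δ , δ≗ , rowγ₀) = row (γ zero)
  in γ zero Vector.∷ δ , (λ { zero → refl ; (suc i) → δ≗ i }) ,
     trans (sum-delta _ (γ zero) otherRows) rowγ₀
  where
  row : ∀ b → ∃ λ δ → δ ≗ tail γ × sumMaps j (λ β → E (b Vector.∷ β)) ≡ E (b Vector.∷ δ)
  row b = sumMaps-concentrated j _ (tail γ) (λ β β≉ → vanish _ (λ b∷β≗γ → β≉ (b∷β≗γ ∘ suc)))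
  otherRows : ∀ b → b ≢ γ zero → sumMaps j (λ β → E (b Vector.∷ β)) ≡ 0ℚ
  otherRows b b≢γ₀ with row b
  ... | δ , _ , s = trans s (vanish _ (λ b∷δ≗γ → b≢γ₀ (b∷δ≗γ zero)))

perm-injective : ∀ {n} (π : Sym n) → Injective _≡_ _≡_ (π ⟨$⟩ʳ_)
perm-injective π = Injection.injective (↔⇒↣ π)

χ-inside : ∀ {k n} (T : Coset k n) (π : Sym n) → π ∈T T → χ T π ≡ 1ℚ
χ-inside ((α , _) , (β , _)) π π∈T with all? (λ i → π ⟨$⟩ʳ α i ≟ β i)
... | yes _    = refl
... | no  π∉T = contradiction π∈T π∉T

χ-outside : ∀ {k n} (T : Coset k n) (π : Sym n) → ¬ π ∈T T → χ T π ≡ 0ℚ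
χ-outside ((α , _) , (β , _)) π π∉T with all? (λ i → π ⟨$⟩ʳ α i ≟ β i)
... | yes π∈T = contradiction π∈T π∉T
... | no  _    = refl

injective? : ∀ {k n} (β : Fin k → Fin n) → Dec (Injective _≡_ _≡_ β)
injective? β with all? (λ x → all? (λ y → (β x ≟ β y) →-dec (x ≟ y)))
... | yes inj = yes (λ {x} {y} → inj x y)
... | no ¬inj = no (λ inj → ¬inj (λ x y → inj))

-- Every function W of the restriction π ∘ α to an injective tuple α lies in V_k, since
-- W (π ∘ α) = Σ_β W β · 1_{T_{α ↦ β}}(π), the sum running over injective β.
InV-restriction : ∀ {k n} (α : Tuple k n) (W : (Fin k → Fin n) → ℚ) →
  (∀ {β β′} → β ≗ β′ → W β ≡ W β′) → InV k (λ π → W (λ i → π ⟨$⟩ʳ proj₁ α i))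
InV-restriction {k} {n} α W W-resp = InV-cong value (InV-sumMaps k k term term∈V)
  where
  termAt : (β : Fin k → Fin n) → Dec (Injective _≡_ _≡_ β) → Sym n → ℚ
  termAt β (yes β-inj) π = W β ℚ.* χ (α , (β , β-inj)) π
  termAt β (no _)      _ = 0ℚ

  term : (Fin k → Fin n) → Sym n → ℚ
  term β = termAt β (injective? β)

  term∈V : ∀ β → InV k (term β)
  term∈V β with injective? β
  ... | yes β-inj = InV-coset (W β) (α , (β , β-inj))
  ... | no  _     = InV-zero

  restrictionOf : Sym n → Fin k → Fin n
  restrictionOf π i = π ⟨$⟩ʳ proj₁ α i

  vanish : ∀ π β → ¬ β ≗ restrictionOf π → term β π ≡ 0ℚ
  vanish π β β≉ with injective? β
  ... | yes β-inj = trans (cong (W β ℚ.*_) (χ-outside (α , (β , β-inj)) π (λ π∈T → β≉ (sym ∘ π∈T))))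
                          (ℚP.*-zeroʳ (W β))
  ... | no  _     = refl

  atCopy : ∀ π γ′ → γ′ ≗ restrictionOf π → term γ′ π ≡ W (restrictionOf π)
  atCopy π γ′ γ′≗γ with injective? γ′
  ... | yes γ′-inj = begin
    W γ′ ℚ.* χ (α , (γ′ , γ′-inj)) π ≡⟨ cong (W γ′ ℚ.*_) (χ-inside (α , (γ′ , γ′-inj)) π (sym ∘ γ′≗γ)) ⟩
    W γ′ ℚ.* 1ℚ                      ≡⟨ ℚP.*-identityʳ (W γ′) ⟩
    W γ′                             ≡⟨ W-resp γ′≗γ ⟩
    W (restrictionOf π)              ∎
  ... | no ¬inj = ⊥-elim (¬inj (λ {x} {y} e →
          proj₂ α (perm-injective π (trans (sym (γ′≗γ x)) (trans e (γ′≗γ y))))))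

  value : ∀ π → W (restrictionOf π) ≡ sumMaps k (λ β → term β π)
  value π =
    let (γ′ , γ′≗γ , sum≡) = sumMaps-concentrated k _ (restrictionOf π) (vanish π)
    in sym (trans sum≡ (atCopy π γ′ γ′≗γ))

avoid : ∀ {m n} (e : Fin (suc m) → Fin n) → Injective _≡_ _≡_ e → (β : Fin m → Fin n) →
  ∃ λ j → ∀ i → β i ≢ e j
avoid {m} e e-inj β with any? (λ j → all? (λ i → ¬? (β i ≟ e j)))
... | yes missed = missed
... | no ¬missed =
  let (j₁ , j₂ , j₁<j₂ , same) = pigeonhole (ℕP.n<1+n m) (proj₁ ∘ covered)
      e-same : e j₁ ≡ e j₂
      e-same = trans (sym (proj₂ (covered j₁))) (trans (cong β same) (proj₂ (covered j₂)))
  in ⊥-elim (ℕP.<-irrefl (cong toℕ (e-inj e-same)) j₁<j₂)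
  where
  covered : ∀ j → ∃ λ i → β i ≡ e j
  covered j with any? (λ i → β i ≟ e j)
  ... | yes hit = hit
  ... | no ¬hit = ⊥-elim (¬missed (j , λ i βi≡ej → ¬hit (i , βi≡ej)))

transpose-hit : ∀ {n} (i j : Fin n) → transpose i j ⟨$⟩ʳ i ≡ j
transpose-hit i j rewrite dec-true (i ≟ i) refl = refl

transpose-miss : ∀ {n} (i j x : Fin n) → x ≢ i → x ≢ j → transpose i j ⟨$⟩ʳ x ≡ x
transpose-miss i j x x≢i x≢j rewrite dec-false (x ≟ i) x≢i | dec-false (x ≟ j) x≢j = refl

redirect : ∀ {m n} (α β : Fin m → Fin n) (σ : Sym n) → (∀ i → σ ⟨$⟩ʳ α i ≡ β i) →
  ∀ a y → (∀ i → α i ≢ a) → (∀ i → β i ≢ y) →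
  ∃ λ π → (∀ i → π ⟨$⟩ʳ α i ≡ β i) × π ⟨$⟩ʳ a ≡ y
        × (∀ x → x ≢ a → σ ⟨$⟩ʳ x ≢ y → π ⟨$⟩ʳ x ≡ σ ⟨$⟩ʳ x)
redirect α β σ σ∈T a y a∉α y∉β =
  σ ∘ₚ swap , stays , transpose-hit (σ ⟨$⟩ʳ a) y ,
  λ x x≢a σx≢y → transpose-miss _ _ _ (x≢a ∘ perm-injective σ) σx≢y
  where
  swap : Sym _
  swap = transpose (σ ⟨$⟩ʳ a) y
  stays : ∀ i → swap ⟨$⟩ʳ (σ ⟨$⟩ʳ α i) ≡ β i
  stays i = trans (cong (swap ⟨$⟩ʳ_) (σ∈T i))
                  (transpose-miss _ _ (β i) (λ βi≡σa → a∉α i (perm-injective σ (trans (σ∈T i) βi≡σa)))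
                                            (y∉β i))

coset-nonempty : ∀ {m n} (α β : Fin m → Fin n) → Injective _≡_ _≡_ α → Injective _≡_ _≡_ β →
  ∃ λ σ → ∀ i → σ ⟨$⟩ʳ α i ≡ β i
coset-nonempty {zero}  α β _     _     = id , λ ()
coset-nonempty {suc m} α β α-inj β-inj with
  coset-nonempty (tail α) (tail β) (λ e → suc-injective (α-inj e)) (λ e → suc-injective (β-inj e))
... | σ , σ∈T with redirect (tail α) (tail β) σ σ∈T (α zero) (β zero)
                           (λ i e → 0≢1+n (sym (α-inj e))) (λ i e → 0≢1+n (sym (β-inj e)))
...   | π , π∈T , πα₀ , _ = π , λ { zero → πα₀ ; (suc i) → π∈T i }

Aligned : ∀ {n} (k : ℕ) → Sym n → Set
Aligned k π = ImageEqA k π ⊎ ImageDisjA k π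

IsIndicatorOfAligned : ∀ {n} (k : ℕ) → (Sym n → ℚ) → Set
IsIndicatorOfAligned k f = ∀ π → (Aligned k π → f π ≡ 1ℚ) × (¬ Aligned k π → f π ≡ 0ℚ)

InA? : ∀ {n} (k : ℕ) (b : Fin n) → Dec (InA k b)
InA? k b = toℕ b ≤? k

does-true : ∀ {P : Set} (d : Dec P) → does d ≡ true → P
does-true (yes p) _ = p

does-false : ∀ {P : Set} (d : Dec P) → does d ≡ false → ¬ P
does-false (no ¬p) _ = ¬p

module PointsOfA {k n : ℕ} (k<n : suc k ≤ n) where

  injA : Fin (suc k) → Fin n
  injA j = inject≤ j k<n

  injA-injective : Injective _≡_ _≡_ injA
  injA-injective = inject≤-injective k<n k<n _ _

  injA-∈A : ∀ j → InA k (injA j)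
  injA-∈A j = subst (_≤ k) (sym (toℕ-inject≤ j k<n)) (ℕP.≤-pred (toℕ<n j))

  injA-onto : ∀ {b} → InA k b → ∃ λ j → injA j ≡ b
  injA-onto b∈A = fromℕ< (s≤s b∈A) , toℕ-injective (trans (toℕ-inject≤ _ k<n) (toℕ-fromℕ< _))

  hitsA : Sym n → Vector Bool (suc k)
  hitsA π j = does (InA? k (π ⟨$⟩ʳ injA j))

  MapsInto : Sym n → Set
  MapsInto π = ∀ j → InA k (π ⟨$⟩ʳ injA j)

  MapsOut : Sym n → Set
  MapsOut π = ∀ j → ¬ InA k (π ⟨$⟩ʳ injA j)

  allHit⇔mapsInto : ∀ π → isStep (suc k) (hitsA π) ≡ true ⇔ MapsInto π
  allHit⇔mapsInto π = mk⇔ (λ e j → does-true (InA? k _) (isStep-all (hitsA π) e j))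
                          (λ into → isStep-all⁻¹ (hitsA π) (λ j → dec-true (InA? k _) (into j)))

  noneHit⇔mapsOut : ∀ π → isStep 0 (hitsA π) ≡ true ⇔ MapsOut π
  noneHit⇔mapsOut π = mk⇔ (λ e j → does-false (InA? k _) (isStep-none (hitsA π) e j))
                          (λ out → isStep-none⁻¹ (hitsA π) (λ j → dec-false (InA? k _) (out j)))

  mapsOut⇔imageDisj : ∀ π → MapsOut π ⇔ ImageDisjA k π
  mapsOut⇔imageDisj π = mk⇔ toDisj (λ disjoint j → disjoint _ (injA j , injA-∈A j , refl))
    where
    toDisj : MapsOut π → ImageDisjA k π
    toDisj out b (a , a∈A , refl) πa∈A with injA-onto a∈A
    ... | j , refl = out j πa∈A

  -- If π maps A into A it maps A onto A, since π is injective and A is finite.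
  mapsInto⇔imageEq : ∀ π → MapsInto π ⇔ ImageEqA k π
  mapsInto⇔imageEq π = mk⇔ (λ into b → image⊆A into b , A⊆image into)
                           (λ eq j → proj₁ (eq _) (injA j , injA-∈A j , refl))
    where
    image⊆A : MapsInto π → ∀ b → InImageA k π b → InA k b
    image⊆A into b (a , a∈A , refl) with injA-onto a∈A
    ... | j , refl = into j
    A⊆image : MapsInto π → ∀ {b} → InA k b → InImageA k π b
    A⊆image into b∈A with injA-onto b∈A
    ... | c , refl with avoid (λ j → π ⟨$⟩ʳ injA j) (λ e → injA-injective (perm-injective π e))
                              (λ i → injA (punchIn c i))
    ...   | j , missed with injA-onto (into j)
    ...     | d , injAd≡πj with d ≟ c
    ...       | yes refl = injA j , injA-∈A j , sym injAd≡πj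
    ...       | no  d≢c  = ⊥-elim (missed (punchOut (d≢c ∘ sym))
                                          (trans (cong injA (punchIn-punchOut (d≢c ∘ sym))) injAd≡πj))

  unaligned : ∀ π → ¬ MapsInto π → ¬ MapsOut π → ¬ Aligned k π
  unaligned π ¬into ¬out (inj₁ eq)       = ¬into (Equivalence.from (mapsInto⇔imageEq π) eq)
  unaligned π ¬into ¬out (inj₂ disjoint) = ¬out (Equivalence.from (mapsOut⇔imageDisj π) disjoint)

  f-value : ∀ f → IsIndicatorOfAligned k f → ∀ π →
    f π ≡ 𝟙 (isStep 0 (hitsA π)) + 𝟙 (isStep (suc k) (hitsA π))
  f-value f f-ind π with isStep 0 (hitsA π) in noneHit | isStep (suc k) (hitsA π) in allHit
  ... | true  | true  = ⊥-elim (out zero (into zero))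
    where
    out : MapsOut π
    out = Equivalence.to (noneHit⇔mapsOut π) noneHit
    into : MapsInto π
    into = Equivalence.to (allHit⇔mapsInto π) allHit
  ... | true  | false = proj₁ (f-ind π)
    (inj₂ (Equivalence.to (mapsOut⇔imageDisj π) (Equivalence.to (noneHit⇔mapsOut π) noneHit)))
  ... | false | true  = proj₁ (f-ind π)
    (inj₁ (Equivalence.to (mapsInto⇔imageEq π) (Equivalence.to (allHit⇔mapsInto π) allHit)))
  ... | false | false = proj₂ (f-ind π) (unaligned π
    (λ into → contradiction (trans (sym allHit) (Equivalence.from (allHit⇔mapsInto π) into)) λ ())
    (λ out  → contradiction (trans (sym noneHit) (Equivalence.from (noneHit⇔mapsOut π) out)) λ ()))

  omitA : Fin (suc k) → Tuple k n
  omitA a = (λ i → injA (punchIn a i)) , λ e → punchIn-injective a _ _ (injA-injective e)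

  f∈V : ∀ f → 2 ∣ k → IsIndicatorOfAligned k f → InV k f
  f∈V f (divides q k≡q*2) f-ind =
    InV-cong expand (InV-sum k (suc k) _ (λ a → InV-restriction (omitA a) (W a) (W-resp a)))
    where
    W : Fin (suc k) → (Fin k → Fin n) → ℚ
    W a β = sign (toℕ a) ℚ.* 𝟙 (isStep (toℕ a) (λ i → does (InA? k (β i))))

    W-resp : ∀ a {β β′} → β ≗ β′ → W a β ≡ W a β′
    W-resp a β≗β′ = cong (λ b → sign (toℕ a) ℚ.* 𝟙 b)
                         (isStep-cong (toℕ a) (λ i → cong (does ∘ InA? k) (β≗β′ i)))

    expand : ∀ π → f π ≡ sum (λ a → W a (λ i → π ⟨$⟩ʳ injA (punchIn a i)))
    expand π = begin
      f π                                        ≡⟨ f-value f f-ind π ⟩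
      𝟙 (isStep 0 Y) + 𝟙 (isStep (suc k) Y)         ≡⟨ cong (𝟙 (isStep 0 Y) +_) (ℚP.*-identityˡ _) ⟨
      𝟙 (isStep 0 Y) + 1ℚ ℚ.* 𝟙 (isStep (suc k) Y)  ≡⟨ cong (λ s → 𝟙 (isStep 0 Y) + s ℚ.* 𝟙 (isStep (suc k) Y)) signk≡1 ⟨
      𝟙 (isStep 0 Y) + sign k ℚ.* 𝟙 (isStep (suc k) Y) ≡⟨ alternating-removeAt k Y ⟨
      sum (λ a → sign (toℕ a) ℚ.* 𝟙 (isStep (toℕ a) (removeAt Y a))) ∎
      where
      Y : Vector Bool (suc k)
      Y = hitsA π
      signk≡1 : sign k ≡ 1ℚ
      signk≡1 = trans (cong sign k≡q*2) (sign-even q)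

  module _ (room : 2 * suc k ≤ n) where

    -- The block B = {k+1, …, 2k+1}: k+1 points outside A, available because n ≥ 2(k+1).
    injB : Fin (suc k) → Fin n
    injB j = fromℕ< (ℕP.<-≤-trans (ℕP.+-monoʳ-< (suc k) (ℕP.<-≤-trans (toℕ<n j) (ℕP.m≤m+n (suc k) 0)))
                                  room)

    injB-injective : Injective _≡_ _≡_ injB
    injB-injective e = toℕ-injective (ℕP.+-cancelˡ-≡ (suc k) _ _
      (trans (sym (toℕ-fromℕ< _)) (trans (cong toℕ e) (toℕ-fromℕ< _))))

    injB-∉A : ∀ j → ¬ InA k (injB j)
    injB-∉A j injBj∈A = ℕP.n≮n k (ℕP.m+n≤o⇒m≤o (suc k) (subst (_≤ k) (toℕ-fromℕ< _) injBj∈A))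

    -- Every k-coset contains a permutation sending part of A into A and part of it outside:
    -- some point a of A is free in the coset, and it can be sent to a free target inside A
    -- (if the coset member maps A outside A) or inside B (if it maps A into A).
    coset-meets-unaligned : 0 < k → (T : Coset k n) → ∃ λ π → π ∈T T × ¬ MapsInto π × ¬ MapsOut π
    coset-meets-unaligned 0<k T@((α , α-inj) , (β , β-inj)) =
      let (σ , σ∈T) = coset-nonempty α β α-inj β-inj in unalignedNear σ σ∈T
      where
      j₀ : Fin (suc k)
      j₀ = proj₁ (avoid injA injA-injective α)
      a∉α : ∀ i → α i ≢ injA j₀
      a∉α = proj₂ (avoid injA injA-injective α)

      j₂ : Fin (suc k)
      j₂ = punchIn j₀ (fromℕ< 0<k)

      moveTo : ∀ σ → σ ∈T T → ∀ y → (∀ i → β i ≢ y) → σ ⟨$⟩ʳ injA j₂ ≢ y →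
        ∃ λ π → π ∈T T × π ⟨$⟩ʳ injA j₀ ≡ y × π ⟨$⟩ʳ injA j₂ ≡ σ ⟨$⟩ʳ injA j₂
      moveTo σ σ∈T y y∉β σa₂≢y =
        let (π , π∈T , πa , keeps) = redirect α β σ σ∈T (injA j₀) y a∉α y∉β
        in π , π∈T , πa , keeps _ (λ e → punchInᵢ≢i j₀ _ (injA-injective e)) σa₂≢y

      unalignedNear : ∀ σ → σ ∈T T → ∃ λ π → π ∈T T × ¬ MapsInto π × ¬ MapsOut π
      unalignedNear σ σ∈T with all? (λ j → InA? k (σ ⟨$⟩ʳ injA j)) | all? (λ j → ¬? (InA? k (σ ⟨$⟩ʳ injA j)))
      ... | no ¬into | no ¬out = σ , σ∈T , ¬into , ¬out
      ... | yes into | _ =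
        let (j , y∉β) = avoid injB injB-injective β
            (π , π∈T , πa , πa₂) = moveTo σ σ∈T (injB j) y∉β (λ e → injB-∉A j (subst (InA k) e (into j₂)))
        in π , π∈T , (λ into′ → injB-∉A j (subst (InA k) πa (into′ j₀)))
                   , (λ out′ → out′ j₂ (subst (InA k) (sym πa₂) (into j₂)))
      ... | no _ | yes out =
        let (j , y∉β) = avoid injA injA-injective β
            (π , π∈T , πa , πa₂) = moveTo σ σ∈T (injA j) y∉β (λ e → out j₂ (subst (InA k) (sym e) (injA-∈A j)))
        in π , π∈T , (λ into′ → out j₂ (subst (InA k) πa₂ (into′ j₂)))
                   , (λ out′ → out′ j₀ (subst (InA k) (sym πa) (injA-∈A j)))

    noCosetInSupport : 0 < k → ∀ f → IsIndicatorOfAligned k f → ¬ SupportContainsCoset k f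
    noCosetInSupport 0<k f f-ind (T , T⊆supp) =
      let (π , π∈T , ¬into , ¬out) = coset-meets-unaligned 0<k T
      in T⊆supp π π∈T (proj₂ (f-ind π) (unaligned π ¬into ¬out))

-- A characteristic function of a disjoint union of k-cosets that is somewhere nonzero
-- has a whole k-coset (the first one of the union) inside its support.
charUnion⇒cosetInSupport : ∀ {n k} (g : Sym n → ℚ) → IsCharDisjointUnion k g →
  ∀ π → g π ≡ 1ℚ → SupportContainsCoset k g
charUnion⇒cosetInSupport g (List.[] , _ , char) π gπ≡1 =
  contradiction (trans (sym gπ≡1) (proj₂ (char π) λ ())) λ ()
charUnion⇒cosetInSupport g (T List.∷ _ , _ , char) _ _ =
  T , λ π π∈T gπ≡0 → contradiction (trans (sym (proj₁ (char π) (here π∈T))) gπ≡0) λ ()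

id-imageEq : ∀ {n} k → ImageEqA {n} k id
id-imageEq k b = (λ { (a , a∈A , refl) → a∈A }) , (λ b∈A → b , b∈A , refl)

mainTheorem1 : (k n : ℕ) → 2 ≤ k → 2 ∣ k → 2 * suc k ≤ n →
    (f : Sym n → ℚ) →
    (∀ π → (ImageEqA k π ⊎ ImageDisjA k π → f π ≡ 1ℚ)
         × (¬ (ImageEqA k π ⊎ ImageDisjA k π) → f π ≡ 0ℚ)) →
    InV k f × ¬ SupportContainsCoset k f × ¬ IsCharDisjointUnion k f
-- f ∈ V_k by the alternating identity; the coset argument needs k ≥ 1 and n ≥ 2(k+1);
-- and f(id) = 1 rules out a disjoint union of cosets.
mainTheorem1 k n 2≤k 2∣k room f f-ind = f∈V f 2∣k f-ind , noCoset , noUnion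
  where
  open PointsOfA (ℕP.m+n≤o⇒m≤o (suc k) room)
  noCoset : ¬ SupportContainsCoset k f
  noCoset = noCosetInSupport room (ℕP.<-≤-trans (s≤s z≤n) 2≤k) f f-ind
  noUnion : ¬ IsCharDisjointUnion k f
  noUnion union = noCoset (charUnion⇒cosetInSupport f union id (proj₁ (f-ind id) (inj₁ (id-imageEq k))))
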